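{- Let $G$ be a 3-uniform hypergraph with vertex set $V$ and $m\ge 10$ edges. If $G$ has two vertices each of degree $\lceil\frac{3}{5}m\rceil -1$, then there is a partition of $V$ into three good sets.
   Context: A 3-uniform hypergraph has a finite vertex set $V$ and $m$ edges that are distinct 3-element subsets of $V$. The degree of a vertex is the number of edges containing it. A set of vertices is good if it meets (has nonempty intersection with) at least $\frac{3}{5}m$ edges. -}

module Defs where

open import Data.Nat using (ℕ; _+_; _*_; _≤_; _/_)
open import Data.Fin using (Fin)
import Data.Fin
open import Data.Fin.Subset using (Subset; _∈_; ∣_∣)
open import Data.Fin.Subset.Properties using (_∈?_)
open import Data.List using (List; length; filter)
open import Data.List.Relation.Unary.Unique.Propositional using (Unique)
open import Data.List.Relation.Unary.All using (All)
open import Data.Product using (Σ; ∃; _×_; _,_)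
open import Relation.Nullary using (Dec; ¬_)
open import Relation.Nullary.Decidable using (_×-dec_; does)
open import Data.Vec using (tabulate)
open import Relation.Nullary.Decidable using (map′)
open import Relation.Binary.PropositionalEquality using (_≡_)
open import Data.Fin.Properties using (any?)

record Hypergraph3 (n : ℕ) : Set where
  field
    edges    : List (Subset n)
    distinct : Unique edges
    uniform  : All (λ e → ∣ e ∣ ≡ 3) edges

open Hypergraph3 public

numEdges : ∀ {n} → Hypergraph3 n → ℕ
numEdges G = length (edges G)

degree : ∀ {n} → Hypergraph3 n → Fin n → ℕ
degree G v = length (filter (λ e → v ∈? e) (edges G))

Meets : ∀ {n} → Subset n → Subset n → Set
Meets {n} S e = ∃ λ (v : Fin n) → v ∈ S × v ∈ e

meets? : ∀ {n} (S e : Subset n) → Dec (Meets S e)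
meets? S e = any? (λ v → v ∈? S ×-dec v ∈? e)

hitCount : ∀ {n} → Hypergraph3 n → Subset n → ℕ
hitCount G S = length (filter (meets? S) (edges G))

Good : ∀ {n} → Hypergraph3 n → Subset n → Set
Good G S = 3 * numEdges G ≤ 5 * hitCount G S

ceil3m/5 : ℕ → ℕ
ceil3m/5 m = (3 * m + 4) / 5

-- the k-th block of a partition of Fin n into three (labelled) parts,
-- given as a map assigning each vertex its part
block : ∀ {n} → (Fin n → Fin 3) → Fin 3 → Subset n
block p k = tabulate (λ v → does (p v Data.Fin.≟ k))

-- Since ⌈3m/5⌉ - 1 < m, some edge e avoids u and some edge f avoids w; pick x ∈ e outside {u, w}
-- and y ∈ f outside {u, x}.  The part {u, x} meets the ⌈3m/5⌉ - 1 edges at u and also e, and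
-- likewise {w, y} meets ⌈3m/5⌉ edges.  The rest of V misses only edges inside the 4-set
-- {u, x, w, y}; there are at most four such edges, and m - 4 ≥ 3m/5 because m ≥ 10.
module Submission where

open import Defs
open import Data.Nat using (ℕ; zero; suc; _+_; _*_; _≤_; _<_; _∸_; _/_; _%_; z≤n; s≤s; NonZero)
open import Data.Nat.DivMod using (m≡m%n+[m/n]*n; m%n<n; m<n*o⇒m/o<n)
open import Data.Nat.Properties
open import Data.Fin using (Fin; zero; suc)
open import Data.Vec using ([]; _∷_)
open import Data.Vec.Properties using (lookup⇒[]=; lookup∘tabulate)
open import Data.Fin.Subset using (Subset; inside; outside; _∈_; _∉_; _⊆_; ∣_∣; ⁅_⁆; _∪_; _-_; ⋃)
open import Data.Fin.Subset.Properties
  using (_∈?_; ∣p∣≤∣x∷p∣; p⊆q⇒∣p∣≤∣q∣; ∣⊥∣≡0; ∣⁅x⁆∣≡1; x∈⁅x⁆; x∈p∪q⁺; ⊆-antisym; p⊂q⇒∣p∣<∣q∣; x∈p∧x≢y⇒x∈p-y; x∈p⇒∣p-x∣<∣p∣)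
import Data.Fin.Properties as Fin
open import Data.List using (List; []; _∷_; _++_; length; filter; map)
open import Data.List.Properties using (filter-accept; filter-reject; filter-all; length-removeAt′; length-map)
open import Data.List.Membership.Propositional using (find; lose) renaming (_∈_ to _∈ₗ_; _∉_ to _∉ₗ_)
open import Data.List.Membership.Propositional.Properties using (∈-map⁺; ∈-filter⁻; ∈-++⁺ˡ; ∈-++⁺ʳ)
open import Data.List.Relation.Unary.Unique.Propositional.Properties using (filter⁺)
import Data.List.Membership.DecPropositional as DecMembership
open import Data.List.Relation.Binary.Subset.Propositional using () renaming (_⊆_ to _⊆ₗ_)
open import Data.List.Relation.Binary.Sublist.Propositional using (⊆-refl)
open import Data.List.Relation.Binary.Sublist.Propositional.Properties using (length-mono-≤) renaming (filter⁺ to sublist-filter⁺)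
open import Data.List.Relation.Unary.Any as Any using (Any; here; there; _─_)
open import Data.List.Relation.Unary.All as All using (All; []; _∷_)
open import Data.List.Relation.Unary.All.Properties using (¬All⇒Any¬; ¬Any⇒All¬; All¬⇒¬Any)
open import Data.List.Relation.Unary.AllPairs using ([]; _∷_)
open import Data.List.Relation.Unary.Unique.Propositional using (Unique)
open import Data.Product using (∃; _×_; _,_)
open import Data.Sum using (inj₁; inj₂)
open import Data.Empty using (⊥-elim)
open import Function using (_∘_)
open import Level using (0ℓ)
open import Relation.Nullary using (yes; no; ¬_; ¬?)
open import Relation.Nullary.Decidable using (_×-dec_; decidable-stable; dec-true)
open import Relation.Unary using (Pred; Decidable)
open import Relation.Unary.Properties using (∁?)
open import Relation.Binary.PropositionalEquality using (_≡_; _≢_; refl; sym; trans; cong; subst; ≢-sym)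

module _ {A : Set} where

  length-filter+length-filter-∁ : ∀ {P : Pred A 0ℓ} (P? : Decidable P) xs →
    length (filter P? xs) + length (filter (∁? P?) xs) ≡ length xs
  length-filter+length-filter-∁ P? [] = refl
  length-filter+length-filter-∁ P? (x ∷ xs) with P? x
  ... | yes _ = cong suc (length-filter+length-filter-∁ P? xs)
  ... | no _  = trans (+-suc _ _) (cong suc (length-filter+length-filter-∁ P? xs))

  module _ {P R : Pred A 0ℓ} (P? : Decidable P) (R? : Decidable R) (P⇒R : ∀ {x} → P x → R x) where

    length-filter-mono : ∀ xs → length (filter P? xs) ≤ length (filter R? xs)
    length-filter-mono xs = length-mono-≤ (sublist-filter⁺ P? R? (λ { refl → P⇒R }) (⊆-refl {x = xs}))

    length-filter-< : ∀ {xs} → Any (λ x → R x × ¬ P x) xs →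
      length (filter P? xs) < length (filter R? xs)
    length-filter-< {x ∷ xs} (here (r , ¬p))
      rewrite filter-reject P? {xs = xs} ¬p | filter-accept R? {xs = xs} r = s≤s (length-filter-mono xs)
    length-filter-< {x ∷ xs} (there any) with P? x | R? x
    ... | yes p | yes _ = s≤s (length-filter-< any)
    ... | yes p | no ¬r = ⊥-elim (¬r (P⇒R p))
    ... | no _  | yes _ = m≤n⇒m≤1+n (length-filter-< any)
    ... | no _  | no _  = length-filter-< any

  ∈-─⁺ : ∀ {x z} {ys : List A} (x∈ys : x ∈ₗ ys) → z ∈ₗ ys → z ≢ x → z ∈ₗ (ys ─ x∈ys)
  ∈-─⁺ (here refl)  (here refl)  z≢x = ⊥-elim (z≢x refl)
  ∈-─⁺ (here _)     (there z∈ys) _   = z∈ys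
  ∈-─⁺ (there _)    (here refl)  _   = here refl
  ∈-─⁺ (there x∈ys) (there z∈ys) z≢x = there (∈-─⁺ x∈ys z∈ys z≢x)

  unique⊆⇒length≤ : ∀ {xs ys : List A} → Unique xs → xs ⊆ₗ ys → length xs ≤ length ys
  unique⊆⇒length≤ {[]} [] _ = z≤n
  unique⊆⇒length≤ {x ∷ xs} {ys} (x≢xs ∷ unique) xs⊆ys = begin
    suc (length xs)              ≤⟨ s≤s (unique⊆⇒length≤ unique xs⊆ys─x) ⟩
    suc (length (ys ─ x∈ys))     ≡⟨ sym (length-removeAt′ ys (Any.index x∈ys)) ⟩
    length ys                    ∎
    where
    open ≤-Reasoning
    x∈ys : x ∈ₗ ys
    x∈ys = xs⊆ys (here refl)
    xs⊆ys─x : xs ⊆ₗ (ys ─ x∈ys)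
    xs⊆ys─x z∈xs = ∈-─⁺ x∈ys (xs⊆ys (there z∈xs)) (All.lookup x≢xs z∈xs ∘ sym)

∣p∪q∣≤∣p∣+∣q∣ : ∀ {n} (p q : Subset n) → ∣ p ∪ q ∣ ≤ ∣ p ∣ + ∣ q ∣
∣p∪q∣≤∣p∣+∣q∣ [] [] = z≤n
∣p∪q∣≤∣p∣+∣q∣ (inside ∷ p) (s ∷ q) =
  s≤s (≤-trans (∣p∪q∣≤∣p∣+∣q∣ p q) (+-monoʳ-≤ ∣ p ∣ (∣p∣≤∣x∷p∣ s q)))
∣p∪q∣≤∣p∣+∣q∣ (outside ∷ p) (inside ∷ q) =
  ≤-trans (s≤s (∣p∪q∣≤∣p∣+∣q∣ p q)) (≤-reflexive (sym (+-suc ∣ p ∣ ∣ q ∣)))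
∣p∪q∣≤∣p∣+∣q∣ (outside ∷ p) (outside ∷ q) = ∣p∪q∣≤∣p∣+∣q∣ p q

module _ {n : ℕ} where

  fromList : List (Fin n) → Subset n
  fromList = ⋃ ∘ map ⁅_⁆

  ∈-fromList⁺ : ∀ {v vs} → v ∈ₗ vs → v ∈ fromList vs
  ∈-fromList⁺ (here refl) = x∈p∪q⁺ (inj₁ (x∈⁅x⁆ _))
  ∈-fromList⁺ (there v∈vs) = x∈p∪q⁺ (inj₂ (∈-fromList⁺ v∈vs))

  ∣fromList∣≤length : ∀ vs → ∣ fromList vs ∣ ≤ length vs
  ∣fromList∣≤length [] = ≤-reflexive (∣⊥∣≡0 n)
  ∣fromList∣≤length (v ∷ vs) = begin
    ∣ ⁅ v ⁆ ∪ fromList vs ∣        ≤⟨ ∣p∪q∣≤∣p∣+∣q∣ ⁅ v ⁆ (fromList vs) ⟩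
    ∣ ⁅ v ⁆ ∣ + ∣ fromList vs ∣    ≡⟨ cong (_+ ∣ fromList vs ∣) (∣⁅x⁆∣≡1 v) ⟩
    suc ∣ fromList vs ∣           ≤⟨ s≤s (∣fromList∣≤length vs) ⟩
    suc (length vs)               ∎
    where open ≤-Reasoning

unique⊆⇒length≤∣p∣ : ∀ {n} {p : Subset n} {vs} → Unique vs → All (_∈ p) vs → length vs ≤ ∣ p ∣
unique⊆⇒length≤∣p∣ [] [] = z≤n
unique⊆⇒length≤∣p∣ {p = p} {v ∷ vs} (v≢vs ∷ unique) (v∈p ∷ vs⊆p) =
  ≤-trans (s≤s (unique⊆⇒length≤∣p∣ unique vs⊆p-v)) (x∈p⇒∣p-x∣<∣p∣ v∈p)
  where
  vs⊆p-v : All (_∈ p - v) vs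
  vs⊆p-v = All.zipWith (λ (v≢z , z∈p) → x∈p∧x≢y⇒x∈p-y z∈p (v≢z ∘ sym)) (v≢vs , vs⊆p)

p⊆q∧∣q∣≤∣p∣⇒p≡q : ∀ {n} {p q : Subset n} → p ⊆ q → ∣ q ∣ ≤ ∣ p ∣ → p ≡ q
p⊆q∧∣q∣≤∣p∣⇒p≡q {p = p} {q} p⊆q ∣q∣≤∣p∣ with Fin.any? (λ x → x ∈? q ×-dec ¬? (x ∈? p))
... | yes (x , x∈q , x∉p) = ⊥-elim (<⇒≱ (p⊂q⇒∣p∣<∣q∣ (p⊆q , x , x∈q , x∉p)) ∣q∣≤∣p∣)
... | no q⊈p = ⊆-antisym p⊆q (λ {x} x∈q → decidable-stable (x ∈? p) (λ x∉p → q⊈p (x , x∈q , x∉p)))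

module _ {n : ℕ} where

  open DecMembership (Fin._≟_ {n}) using () renaming (_∈?_ to _∈ₗ?_)

  length<∣p∣⇒∃∈p∉vs : ∀ (p : Subset n) vs → length vs < ∣ p ∣ → ∃ λ v → v ∈ p × All (v ≢_) vs
  length<∣p∣⇒∃∈p∉vs p vs ∣vs∣<∣p∣ with Fin.any? (λ v → v ∈? p ×-dec ¬? (v ∈ₗ? vs))
  ... | yes (v , v∈p , v∉vs) = v , v∈p , ¬Any⇒All¬ vs v∉vs
  ... | no none = ⊥-elim (<⇒≱ ∣vs∣<∣p∣ (≤-trans (p⊆q⇒∣p∣≤∣q∣ p⊆vs) (∣fromList∣≤length vs)))
    where
    p⊆vs : p ⊆ fromList vs
    p⊆vs {v} v∈p = ∈-fromList⁺ (decidable-stable (v ∈ₗ? vs) (λ v∉vs → none (v , v∈p , v∉vs)))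

  ∣p∣<length⇒∃∈vs∉p : ∀ (p : Subset n) {vs} → Unique vs → ∣ p ∣ < length vs → ∃ λ v → v ∈ₗ vs × v ∉ p
  ∣p∣<length⇒∃∈vs∉p p {vs} unique ∣p∣<∣vs∣ with All.all? (_∈? p) vs
  ... | yes vs⊆p = ⊥-elim (<⇒≱ ∣p∣<∣vs∣ (unique⊆⇒length≤∣p∣ unique vs⊆p))
  ... | no vs⊈p = find (¬All⇒Any¬ (_∈? p) vs vs⊈p)

  deletions : List (Fin n) → List (Subset n)
  deletions vs = map (fromList vs -_) vs

  ⊆vs∧1+∣g∣≡length⇒g∈deletions : ∀ {g : Subset n} {vs} → Unique vs → (∀ {v} → v ∈ g → v ∈ₗ vs) →
    length vs ≡ suc ∣ g ∣ → g ∈ₗ deletions vs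
  ⊆vs∧1+∣g∣≡length⇒g∈deletions {g} {vs} unique g⊆vs ∣vs∣≡1+∣g∣
    with ∣p∣<length⇒∃∈vs∉p g unique (≤-reflexive (sym ∣vs∣≡1+∣g∣))
  ... | z , z∈vs , z∉g = subst (_∈ₗ deletions vs) g≡vs-z (∈-map⁺ (fromList vs -_) z∈vs)
    where
    g⊆vs-z : g ⊆ fromList vs - z
    g⊆vs-z v∈g = x∈p∧x≢y⇒x∈p-y (∈-fromList⁺ (g⊆vs v∈g)) (λ { refl → z∉g v∈g })
    ∣vs-z∣≤∣g∣ : ∣ fromList vs - z ∣ ≤ ∣ g ∣
    ∣vs-z∣≤∣g∣ = ≤-pred (≤-trans (x∈p⇒∣p-x∣<∣p∣ (∈-fromList⁺ z∈vs))
                         (≤-trans (∣fromList∣≤length vs) (≤-reflexive ∣vs∣≡1+∣g∣)))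
    g≡vs-z : fromList vs - z ≡ g
    g≡vs-z = sym (p⊆q∧∣q∣≤∣p∣⇒p≡q g⊆vs-z ∣vs-z∣≤∣g∣)

m≤[m+n∸1]/n*n : ∀ m n .{{_ : NonZero n}} → m ≤ (m + (n ∸ 1)) / n * n
m≤[m+n∸1]/n*n m n = +-cancelʳ-≤ (n ∸ 1) m _ (begin
  m + (n ∸ 1)                       ≡⟨ m≡m%n+[m/n]*n (m + (n ∸ 1)) n ⟩
  (m + (n ∸ 1)) % n + q * n          ≤⟨ +-monoˡ-≤ (q * n) r≤n∸1 ⟩
  (n ∸ 1) + q * n                    ≡⟨ +-comm (n ∸ 1) (q * n) ⟩
  q * n + (n ∸ 1)                    ∎)
  where
  open ≤-Reasoning
  q : ℕ
  q = (m + (n ∸ 1)) / n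
  r≤n∸1 : (m + (n ∸ 1)) % n ≤ n ∸ 1
  r≤n∸1 = ≤-pred (≤-trans (m%n<n (m + (n ∸ 1)) n) (m≤n+m∸n n 1))

⌈3m/5⌉≤⇒3m≤5* : ∀ m h → ceil3m/5 m ≤ h → 3 * m ≤ 5 * h
⌈3m/5⌉≤⇒3m≤5* m h ⌈3m/5⌉≤h = begin
  3 * m                 ≤⟨ m≤[m+n∸1]/n*n (3 * m) 5 ⟩
  ceil3m/5 m * 5        ≤⟨ *-monoˡ-≤ 5 ⌈3m/5⌉≤h ⟩
  h * 5                 ≡⟨ *-comm h 5 ⟩
  5 * h                 ∎
  where open ≤-Reasoning

⌈3m/5⌉≤m : ∀ m → ceil3m/5 m ≤ m
⌈3m/5⌉≤m m = ≤-pred (m<n*o⇒m/o<n (begin-strict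
  3 * m + 4     <⟨ +-monoʳ-< (3 * m) (n<1+n 4) ⟩
  3 * m + 5     ≤⟨ +-monoˡ-≤ 5 (*-monoˡ-≤ m (m≤m+n 3 2)) ⟩
  5 * m + 5     ≡⟨ trans (+-comm (5 * m) 5) (cong (5 +_) (*-comm 5 m)) ⟩
  suc m * 5     ∎))
  where open ≤-Reasoning

⌈3m/5⌉∸1<m : ∀ {m} → 1 ≤ m → ceil3m/5 m ∸ 1 < m
⌈3m/5⌉∸1<m {suc k} _ = s≤s (∸-monoˡ-≤ 1 (⌈3m/5⌉≤m (suc k)))

10≤m∧m≤h+4⇒3m≤5h : ∀ {m h} → 10 ≤ m → m ≤ h + 4 → 3 * m ≤ 5 * h
10≤m∧m≤h+4⇒3m≤5h {m} {h} 10≤m m≤h+4 = +-cancelʳ-≤ 20 (3 * m) (5 * h) (begin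
  3 * m + 20        ≤⟨ +-monoʳ-≤ (3 * m) (*-monoʳ-≤ 2 10≤m) ⟩
  3 * m + 2 * m     ≡⟨ sym (*-distribʳ-+ m 3 2) ⟩
  5 * m             ≤⟨ *-monoʳ-≤ 5 m≤h+4 ⟩
  5 * (h + 4)       ≡⟨ *-distribˡ-+ 5 h 4 ⟩
  5 * h + 20        ∎)
  where open ≤-Reasoning

module _ {n : ℕ} (G : Hypergraph3 n) where

  degree<numEdges⇒∃edge∌ : ∀ {u} → degree G u < numEdges G → ∃ λ e → e ∈ₗ edges G × u ∉ e
  degree<numEdges⇒∃edge∌ {u} deg<m with All.all? (u ∈?_) (edges G)
  ... | yes all∋u = ⊥-elim (<-irrefl (cong length (filter-all (u ∈?_) all∋u)) deg<m)
  ... | no ¬all∋u = find (¬All⇒Any¬ (u ∈?_) (edges G) ¬all∋u)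

  degree<hitCount : ∀ {u e S} → u ∈ S → e ∈ₗ edges G → u ∉ e → Meets S e → degree G u < hitCount G S
  degree<hitCount {u} {e} {S} u∈S e∈E u∉e S∩e =
    length-filter-< (u ∈?_) (meets? S) (λ u∈f → u , u∈S , u∈f) (lose e∈E (S∩e , u∉e))

  -- A missed edge is a 3-subset of the 4-set vs, hence one of its 4 deletions.
  numEdges≤hitCount+4 : ∀ {S vs} → Unique vs → length vs ≡ 4 →
    (∀ {e} → e ∈ₗ edges G → ¬ Meets S e → ∀ {v} → v ∈ e → v ∈ₗ vs) →
    numEdges G ≤ hitCount G S + 4
  numEdges≤hitCount+4 {S} {vs} unique ∣vs∣≡4 missed⊆vs = begin
    numEdges G                              ≡⟨ sym (length-filter+length-filter-∁ (meets? S) (edges G)) ⟩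
    hitCount G S + length missed            ≤⟨ +-monoʳ-≤ (hitCount G S) missed≤deletions ⟩
    hitCount G S + length (deletions vs)    ≡⟨ cong (hitCount G S +_) (trans (length-map _ vs) ∣vs∣≡4) ⟩
    hitCount G S + 4                        ∎
    where
    open ≤-Reasoning
    missed : List (Subset n)
    missed = filter (∁? (meets? S)) (edges G)
    missed⊆deletions : missed ⊆ₗ deletions vs
    missed⊆deletions e∈missed with e∈E , S∌e ← ∈-filter⁻ (∁? (meets? S)) e∈missed =
      ⊆vs∧1+∣g∣≡length⇒g∈deletions unique (missed⊆vs e∈E S∌e)
        (trans ∣vs∣≡4 (cong suc (sym (All.lookup (uniform G) e∈E))))
    missed≤deletions : length missed ≤ length (deletions vs)
    missed≤deletions = unique⊆⇒length≤ (filter⁺ (∁? (meets? S)) (distinct G)) missed⊆deletions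

  ∃∈edge∖pair : ∀ {e} → e ∈ₗ edges G → ∀ a b → ∃ λ v → v ∈ e × v ≢ a × v ≢ b
  ∃∈edge∖pair e∈E a b with v , v∈e , v≢a ∷ v≢b ∷ [] ← length<∣p∣⇒∃∈p∉vs _ (a ∷ b ∷ [])
                                                       (≤-reflexive (sym (All.lookup (uniform G) e∈E))) =
    v , v∈e , v≢a , v≢b

  degree≡⌈3m/5⌉∸1⇒∃edge∌ : ∀ {u} → 1 ≤ numEdges G → degree G u ≡ ceil3m/5 (numEdges G) ∸ 1 →
    ∃ λ e → e ∈ₗ edges G × u ∉ e
  degree≡⌈3m/5⌉∸1⇒∃edge∌ 1≤m deg≡ =
    degree<numEdges⇒∃edge∌ (subst (_< numEdges G) (sym deg≡) (⌈3m/5⌉∸1<m 1≤m))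

  good-by-degree : ∀ {u e S} → degree G u ≡ ceil3m/5 (numEdges G) ∸ 1 →
    u ∈ S → e ∈ₗ edges G → u ∉ e → Meets S e → Good G S
  good-by-degree {u} {e} {S} deg≡ u∈S e∈E u∉e S∩e = ⌈3m/5⌉≤⇒3m≤5* (numEdges G) (hitCount G S) (begin
    ceil3m/5 (numEdges G)                    ≤⟨ m≤n+m∸n _ 1 ⟩
    suc (ceil3m/5 (numEdges G) ∸ 1)          ≡⟨ cong suc (sym deg≡) ⟩
    suc (degree G u)                         ≤⟨ degree<hitCount u∈S e∈E u∉e S∩e ⟩
    hitCount G S                             ∎)
    where open ≤-Reasoning

∈-block⁺ : ∀ {n} (p : Fin n → Fin 3) {v k} → p v ≡ k → v ∈ block p k
∈-block⁺ p {v} {k} pv≡k = lookup⇒[]= v _ (trans (lookup∘tabulate _ v) (dec-true (p v Fin.≟ k) pv≡k))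

module _ {n : ℕ} (A B : List (Fin n)) where

  open DecMembership (Fin._≟_ {n}) using () renaming (_∈?_ to _∈ₗ?_)

  label : Fin n → Fin 3
  label v with v ∈ₗ? A | v ∈ₗ? B
  ... | yes _ | _     = zero
  ... | no _  | yes _ = suc zero
  ... | no _  | no _  = suc (suc zero)

  label-∈A : ∀ {v} → v ∈ₗ A → label v ≡ zero
  label-∈A {v} v∈A with v ∈ₗ? A | v ∈ₗ? B
  ... | yes _   | _ = refl
  ... | no v∉A  | _ = ⊥-elim (v∉A v∈A)

  label-∈B : ∀ {v} → v ∉ₗ A → v ∈ₗ B → label v ≡ suc zero
  label-∈B {v} v∉A v∈B with v ∈ₗ? A | v ∈ₗ? B
  ... | yes v∈A | _      = ⊥-elim (v∉A v∈A)
  ... | no _    | yes _  = refl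
  ... | no _    | no v∉B = ⊥-elim (v∉B v∈B)

  label≢2⇒∈A++B : ∀ {v} → label v ≢ suc (suc zero) → v ∈ₗ A ++ B
  label≢2⇒∈A++B {v} label≢2 with v ∈ₗ? A | v ∈ₗ? B
  ... | yes v∈A | _       = ∈-++⁺ˡ v∈A
  ... | no _    | yes v∈B = ∈-++⁺ʳ A v∈B
  ... | no _    | no _    = ⊥-elim (label≢2 refl)

lemma4 : ∀ {n} (G : Hypergraph3 n) → 10 ≤ numEdges G →
    (u w : Fin n) → u ≢ w →
    degree G u ≡ ceil3m/5 (numEdges G) ∸ 1 →
    degree G w ≡ ceil3m/5 (numEdges G) ∸ 1 →
    ∃ λ (p : Fin n → Fin 3) → ∀ k → Good G (block p k)
lemma4 {n} G 10≤m u w u≢w deg-u deg-w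
  with 1≤m ← ≤-trans (s≤s z≤n) 10≤m
  with e , e∈E , u∉e ← degree≡⌈3m/5⌉∸1⇒∃edge∌ G 1≤m deg-u
  with x , x∈e , x≢u , x≢w ← ∃∈edge∖pair G e∈E u w
  with f , f∈E , w∉f ← degree≡⌈3m/5⌉∸1⇒∃edge∌ G 1≤m deg-w
  with y , y∈f , y≢u , y≢x ← ∃∈edge∖pair G f∈E u x
  = p , good
  where
  p : Fin n → Fin 3
  p = label (u ∷ x ∷ []) (w ∷ y ∷ [])
  y≢w : y ≢ w
  y≢w refl = w∉f y∈f
  u∈A : u ∈ block p zero
  u∈A = ∈-block⁺ p (label-∈A _ _ (here refl))
  x∈A : x ∈ block p zero
  x∈A = ∈-block⁺ p (label-∈A _ _ (there (here refl)))
  w∈B : w ∈ block p (suc zero)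
  w∈B = ∈-block⁺ p (label-∈B _ _ (All¬⇒¬Any (≢-sym u≢w ∷ ≢-sym x≢w ∷ [])) (here refl))
  y∈B : y ∈ block p (suc zero)
  y∈B = ∈-block⁺ p (label-∈B _ _ (All¬⇒¬Any (y≢u ∷ y≢x ∷ [])) (there (here refl)))
  uxwy-distinct : Unique (u ∷ x ∷ w ∷ y ∷ [])
  uxwy-distinct = (≢-sym x≢u ∷ u≢w ∷ ≢-sym y≢u ∷ []) ∷ (x≢w ∷ ≢-sym y≢x ∷ [])
                ∷ (≢-sym y≢w ∷ []) ∷ [] ∷ []
  good : ∀ k → Good G (block p k)
  good zero = good-by-degree G deg-u u∈A e∈E u∉e (x , x∈A , x∈e)
  good (suc zero) = good-by-degree G deg-w w∈B f∈E w∉f (y , y∈B , y∈f)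
  good (suc (suc zero)) = 10≤m∧m≤h+4⇒3m≤5h 10≤m (numEdges≤hitCount+4 G uxwy-distinct refl
    (λ _ C∌g v∈g → label≢2⇒∈A++B _ _ (λ pv≡2 → C∌g (_ , ∈-block⁺ p pv≡2 , v∈g))))
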